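{- For $s\in\mu_r$, $v\in\mathcal{A}_1$ and $w\in\mathcal{A}_r$, \[ v\diamond_s w=\psi_s\bigl(\varphi(v)\ast\psi_s^{ -1}(w)\bigr). \]
   Context: Let $r\ge1$, $\mu_r$ the $r$-th roots of unity, $\mathcal{A}_r=\mathbb{Q}\langle x,y_s\mid s\in\mu_r\rangle$, $y=y_1$, $z=x+y_1$, $z_t=x+y_t$, $\delta(1)=0$, $\delta(s)=1$ for $s\ne1$, $z_{k,s}=x^{k-1}y_s$, $\mathcal{A}_1=\mathbb{Q}\langle x,y\rangle\subset\mathcal{A}_r$. Harmonic product $\ast$ on $\mathcal{A}_r$: $\mathbb{Q}$-bilinear with $1\ast w=w\ast1=w$, $vy_s\ast wy_t=(v\ast wy_t)y_s+(vy_s\ast w)y_t+(v\ast w)xy_{st}$, $vx\ast w=v\ast wx=(v\ast w)x$. $\varphi$: automorphism of $\mathcal{A}_r$ with $\varphi(x)=z$, $\varphi(y_s)=\delta(s)y_s-y_1$. $\mathcal{I}(z_{k_1,s_1}\cdots z_{k_l,s_l}x^a)=z_{k_1,s_1}z_{k_2,s_1s_2}\cdots z_{k_l,s_1\cdots s_l}x^a$, $M_s(z_{k_1,s_1}\cdots z_{k_l,s_l}x^a)=z_{k_1,ss_1}z_{k_2,s_2}\cdots z_{k_l,s_l}x^a$ (linear bijections, $a\ge0$), $\psi_s=\varphi\mathcal{I}M_s$. Diamond product $\diamond_s:\mathcal{A}_1\times\mathcal{A}_r\to\mathcal{A}_r$ ($s\in\mu_r$): $\mathbb{Q}$-bilinear,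 defined recursively for words $v\in\mathcal{A}_1,w\in\mathcal{A}_r$, $1\ne t\in\mu_r$ by $1\diamond_s w=w$, $v\diamond_s1=\psi_s\varphi(v)$, $vx\diamond_s wx=(v\diamond_s wx)x-(vy\diamond_s w)x$, $vy\diamond_s wx=(v\diamond_s wx)y+(vy\diamond_s w)x$, $vx\diamond_s wy=(v\diamond_s wy)x+(vx\diamond_s w)y$, $vy\diamond_s wy=(v\diamond_s wy)y-(vx\diamond_s w)y$, $vx\diamond_s wy_t=(v\diamond_s wy_t)x+(v\diamond_s wz_t)y_t-(vy\diamond_s w)y_t$, $vy\diamond_s wy_t=(v\diamond_s wy_t)y-(v\diamond_s wz_t)y_t+(vy\diamond_s w)y_t$. -}

module Defs where

open import Data.Nat using (ℕ; NonZero)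
import Data.Nat as ℕ
open import Data.Nat.DivMod using (_mod_)
open import Data.Fin using (Fin; toℕ)
import Data.Fin as Fin
open import Data.Bool using (Bool; true; false; if_then_else_; _∧_)
open import Data.List using (List; []; _∷_; _++_; map; concatMap; foldr)
open import Data.Product using (_×_; _,_)
open import Data.Rational using (ℚ; 0ℚ; 1ℚ; _+_; _*_; -_)
open import Relation.Nullary using (does)
open import Relation.Binary.PropositionalEquality using (_≡_)

-- μ_r is the cyclic group of r-th roots of unity.  We identify
-- exp(2πik/r) with k : Fin r; multiplication is addition mod r and
-- the unit 1 is 0.

-- Letters and words of A_r = ℚ⟨x, y_s | s ∈ μ_r⟩.
-- Words are snoc-lists: (w ▷ a) is the word w followed by the letter a.

module _ (r : ℕ) where

  data Letter : Set where
    x : Letter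
    y : Fin r → Letter

  infixl 5 _▷_
  data Word : Set where
    ε   : Word
    _▷_ : Word → Letter → Word

  Poly : Set
  Poly = List (ℚ × Word)

data Letter₁ : Set where
  x₁ y₁ : Letter₁

infixl 5 _▷₁_
data Word₁ : Set where
  ε₁   : Word₁
  _▷₁_ : Word₁ → Letter₁ → Word₁

Poly₁ : Set
Poly₁ = List (ℚ × Word₁)

module _ {r : ℕ} .{{nz : NonZero r}} where

  one : Fin r
  one = 0 mod r

  mul : Fin r → Fin r → Fin r
  mul i j = (toℕ i ℕ.+ toℕ j) mod r

  isOne : Fin r → Bool
  isOne t = does (t Fin.≟ one)

  eqL : Letter r → Letter r → Bool
  eqL x x = true
  eqL x (y _) = false
  eqL (y _) x = false
  eqL (y i) (y j) = does (i Fin.≟ j)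

  eqW : Word r → Word r → Bool
  eqW ε ε = true
  eqW ε (_ ▷ _) = false
  eqW (_ ▷ _) ε = false
  eqW (u ▷ a) (w ▷ b) = eqW u w ∧ eqL a b

  coeff : Poly r → Word r → ℚ
  coeff p w = foldr (λ { (c , u) acc → (if eqW u w then c else 0ℚ) + acc }) 0ℚ p

  infix 4 _≈_
  _≈_ : Poly r → Poly r → Set
  p ≈ q = ∀ w → coeff p w ≡ coeff q w

  word : Word r → Poly r
  word w = (1ℚ , w) ∷ []

  infixl 6 _⊕_ _⊖_
  _⊕_ : Poly r → Poly r → Poly r
  p ⊕ q = p ++ q

  neg : Poly r → Poly r
  neg = map (λ { (c , w) → (- c , w) })

  _⊖_ : Poly r → Poly r → Poly r
  p ⊖ q = p ++ neg q

  scale : ℚ → Poly r → Poly r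
  scale c = map (λ { (d , w) → (c * d , w) })

  infixl 7 _·_
  _·_ : Poly r → Letter r → Poly r
  p · a = map (λ { (c , w) → (c , w ▷ a) }) p

  lin : (Word r → Poly r) → Poly r → Poly r
  lin f p = concatMap (λ { (c , w) → scale c (f w) }) p

  lin₁ : (Word₁ → Poly r) → Poly₁ → Poly r
  lin₁ f p = concatMap (λ { (c , w) → scale c (f w) }) p

  bilin : (Word r → Word r → Poly r) → Poly r → Poly r → Poly r
  bilin f p q = concatMap (λ { (c , u) → concatMap (λ { (d , w) → scale (c * d) (f u w) }) q }) p

  bilin₁ : (Word₁ → Word r → Poly r) → Poly₁ → Poly r → Poly r
  bilin₁ f p q = concatMap (λ { (c , u) → concatMap (λ { (d , w) → scale (c * d) (f u w) }) q }) p

  y1 : Letter r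
  y1 = y one

  embW : Word₁ → Word r
  embW ε₁ = ε
  embW (v ▷₁ x₁) = embW v ▷ x
  embW (v ▷₁ y₁) = embW v ▷ y1

  harmW : Word r → Word r → Poly r
  harmW ε w = word w
  harmW (v ▷ a) ε = word (v ▷ a)
  harmW (v ▷ x) w = harmW v w · x
  harmW (v ▷ y s) (w ▷ x) = harmW (v ▷ y s) w · x
  harmW (v ▷ y s) (w ▷ y t) =
    harmW v (w ▷ y t) · y s ⊕ harmW (v ▷ y s) w · y t ⊕ harmW v w · x · y (mul s t)

  infixl 7 _∗_
  _∗_ : Poly r → Poly r → Poly r
  _∗_ = bilin harmW

  φW : Word r → Poly r
  φW ε = word ε
  φW (w ▷ x) = φW w · x ⊕ φW w · y1
  φW (w ▷ y s) = if isOne s then neg (φW w · y1) else (φW w · y s ⊖ φW w · y1)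

  φ : Poly r → Poly r
  φ = lin φW

  φ₁ : Poly₁ → Poly r
  φ₁ = lin₁ (λ v → φW (embW v))

  -- 𝓘 : z_{k1,s1} ⋯ z_{kl,sl} x^a ↦ z_{k1,s1} z_{k2,s1s2} ⋯ z_{kl,s1⋯sl} x^a
  prodY : Word r → Fin r
  prodY ε = one
  prodY (w ▷ x) = prodY w
  prodY (w ▷ y t) = mul (prodY w) t

  𝓘W : Word r → Word r
  𝓘W ε = ε
  𝓘W (w ▷ x) = 𝓘W w ▷ x
  𝓘W (w ▷ y t) = 𝓘W w ▷ y (mul (prodY w) t)

  -- M_s : z_{k1,s1} z_{k2,s2} ⋯ x^a ↦ z_{k1,s s1} z_{k2,s2} ⋯ x^a
  hasY : Word r → Bool
  hasY ε = false
  hasY (w ▷ x) = hasY w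
  hasY (w ▷ y _) = true

  MW : Fin r → Word r → Word r
  MW s ε = ε
  MW s (w ▷ x) = MW s w ▷ x
  MW s (w ▷ y t) = if hasY w then MW s w ▷ y t else w ▷ y (mul s t)

  ψ : Fin r → Poly r → Poly r
  ψ s = lin (λ w → φW (𝓘W (MW s w)))

  -- diamond product ◇_s : A_1 × A_r → A_r
  -- diaD v a w  stands for  (v a) ◇_s w
  module _ (s : Fin r) where
    mutual
      diaW : Word₁ → Word r → Poly r
      diaW ε₁ w = word w
      diaW (v ▷₁ a) w = diaD v a w

      diaD : Word₁ → Letter₁ → Word r → Poly r
      diaD v a ε = ψ s (φ₁ ((1ℚ , v ▷₁ a) ∷ []))
      diaD v x₁ (w ▷ x) = diaW v (w ▷ x) · x ⊖ diaD v y₁ w · x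
      diaD v y₁ (w ▷ x) = diaW v (w ▷ x) · y1 ⊕ diaD v y₁ w · x
      diaD v x₁ (w ▷ y t) =
        if isOne t
        then diaW v (w ▷ y t) · x ⊕ diaD v x₁ w · y1
        else (diaW v (w ▷ y t) · x ⊕ (diaW v (w ▷ x) ⊕ diaW v (w ▷ y t)) · y t
                ⊖ diaD v y₁ w · y t)
      diaD v y₁ (w ▷ y t) =
        if isOne t
        then diaW v (w ▷ y t) · y1 ⊖ diaD v x₁ w · y1
        else (diaW v (w ▷ y t) · y1 ⊖ (diaW v (w ▷ x) ⊕ diaW v (w ▷ y t)) · y t
                ⊕ diaD v y₁ w · y t)

  ◇ : Fin r → Poly₁ → Poly r → Poly r
  ◇ s = bilin₁ (diaW s)

{-# OPTIONS --safe #-}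
module Submission where

-- Polynomials are compared through their pairings ⟨ p ∣ g ⟩ = Σ c · g(u) with
-- test functions g on words.  Right multiplication by a letter a is dual to
-- g ↦ g ⊲ a, and the pairing depends only on the coefficients of p, so by
-- bilinearity it suffices to show ⟨ v ◇ ψ(u) ∣ g ⟩ = ⟨ ψ(φ(v) ∗ u) ∣ g ⟩ for
-- words v, u and every g.
--
-- ψ_s turns a final x of u into z = x + y, and a final y_t into
-- φ(y_c) = δ(c) y_c − y_1 with c = s · t · (product of the y-indices of u).
-- Every word of φ(v) has index product 1 and ∗ multiplies index products, so
-- the same c occurs in all three terms of the recursion for (p y) ∗ (u y_t).
-- Adding the x- and y-rules of ◇ gives (v z) ◇ w = (v ◇ w) z, matching
-- φ(v x) + φ(v y) = φ(v) z on the other side; hence v x follows from v and v y,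
-- and only v y needs an induction on u, each of whose steps is a linear
-- identity between induction hypotheses.

open import Algebra.Bundles using (CommutativeMonoid)
import Algebra.Solver.CommutativeMonoid as CMSolver
import Algebra.Structures.Biased as Biased
open import Data.Bool using (Bool; true; false; if_then_else_)
open import Data.Fin using (Fin; toℕ)
import Data.Fin.Properties as Fin
open import Data.List using (List; []; _∷_; _++_; concatMap; length)
open import Data.List.Relation.Unary.All using (All; []; _∷_)
import Data.List.Relation.Unary.All as All
import Data.List.Relation.Unary.All.Properties as All
open import Data.Nat using (ℕ; NonZero; suc; s≤s)
import Data.Nat as ℕ
import Data.Nat.Properties as ℕ
open import Data.Nat.DivMod using (_%_; %-distribˡ-+; m%n%n≡m%n; m<n⇒m%n≡m)
open import Data.Product using (_×_; _,_; proj₁; proj₂)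
open import Data.Rational using (ℚ; 0ℚ; 1ℚ; _+_; _*_; -_; _-_)
open import Data.Rational.Properties
  using (+-0-group; +-identityˡ; +-identityʳ; +-assoc; +-inverseʳ; *-identityˡ; *-identityʳ; *-zeroʳ)
open import Data.Rational.Solver using (module +-*-Solver)
open import Function using (it)
open import Level using (0ℓ)
open import Relation.Binary.PropositionalEquality
open import Relation.Nullary using (yes)
open import Relation.Nullary.Decidable using (dec-true)

open import Defs

open import Algebra.Properties.Group +-0-group using (x∙y⁻¹≈ε⇒x≈y; ∙-cancelʳ)
open +-*-Solver
open ≡-Reasoning

-- Pairing formal combinations with test functions

module _ {W : Set} where

  infix 4 ⟨_∣_⟩
  ⟨_∣_⟩ : List (ℚ × W) → (W → ℚ) → ℚ
  ⟨ [] ∣ g ⟩ = 0ℚ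
  ⟨ (c , u) ∷ p ∣ g ⟩ = c * g u + ⟨ p ∣ g ⟩

  ⟨∣⟩-congʳ : ∀ p {f h : W → ℚ} → (∀ u → f u ≡ h u) → ⟨ p ∣ f ⟩ ≡ ⟨ p ∣ h ⟩
  ⟨∣⟩-congʳ [] eq = refl
  ⟨∣⟩-congʳ ((c , u) ∷ p) eq = cong₂ (λ a b → c * a + b) (eq u) (⟨∣⟩-congʳ p eq)

  ⟨∣⟩-congʳ-on : ∀ {P : W → Set} {p} {f h : W → ℚ} →
                All (λ e → P (proj₂ e)) p → (∀ u → P u → f u ≡ h u) → ⟨ p ∣ f ⟩ ≡ ⟨ p ∣ h ⟩
  ⟨∣⟩-congʳ-on [] eq = refl
  ⟨∣⟩-congʳ-on {p = (c , u) ∷ _} (Pu ∷ Pp) eq = cong₂ (λ a b → c * a + b) (eq u Pu) (⟨∣⟩-congʳ-on Pp eq)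

  ⟨∣⟩-+ʳ : ∀ p (f h : W → ℚ) → ⟨ p ∣ (λ u → f u + h u) ⟩ ≡ ⟨ p ∣ f ⟩ + ⟨ p ∣ h ⟩
  ⟨∣⟩-+ʳ [] f h = refl
  ⟨∣⟩-+ʳ ((c , u) ∷ p) f h = begin
      c * (f u + h u) + ⟨ p ∣ (λ u → f u + h u) ⟩
    ≡⟨ cong (c * (f u + h u) +_) (⟨∣⟩-+ʳ p f h) ⟩
      c * (f u + h u) + (⟨ p ∣ f ⟩ + ⟨ p ∣ h ⟩)
    ≡⟨ solve 5 (λ c a b x y → c :* (a :+ b) :+ (x :+ y) := (c :* a :+ x) :+ (c :* b :+ y))
               refl c (f u) (h u) ⟨ p ∣ f ⟩ ⟨ p ∣ h ⟩ ⟩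
      (c * f u + ⟨ p ∣ f ⟩) + (c * h u + ⟨ p ∣ h ⟩) ∎

  ⟨∣⟩-*ʳ : ∀ p a (f : W → ℚ) → ⟨ p ∣ (λ u → a * f u) ⟩ ≡ a * ⟨ p ∣ f ⟩
  ⟨∣⟩-*ʳ [] a f = solve 1 (λ a → con 0ℚ := a :* con 0ℚ) refl a
  ⟨∣⟩-*ʳ ((c , u) ∷ p) a f = begin
      c * (a * f u) + ⟨ p ∣ (λ u → a * f u) ⟩
    ≡⟨ cong (c * (a * f u) +_) (⟨∣⟩-*ʳ p a f) ⟩
      c * (a * f u) + a * ⟨ p ∣ f ⟩
    ≡⟨ solve 4 (λ c a b x → c :* (a :* b) :+ a :* x := a :* (c :* b :+ x)) refl c a (f u) ⟨ p ∣ f ⟩ ⟩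
      a * (c * f u + ⟨ p ∣ f ⟩) ∎


  ⟨∣⟩-zeroʳ : ∀ p → ⟨ p ∣ (λ _ → 0ℚ) ⟩ ≡ 0ℚ
  ⟨∣⟩-zeroʳ [] = refl
  ⟨∣⟩-zeroʳ ((c , u) ∷ p) rewrite ⟨∣⟩-zeroʳ p = solve 1 (λ c → c :* con 0ℚ :+ con 0ℚ := con 0ℚ) refl c

  ⟨∣⟩-negʳ : ∀ p (f : W → ℚ) → ⟨ p ∣ (λ u → - f u) ⟩ ≡ - ⟨ p ∣ f ⟩
  ⟨∣⟩-negʳ [] f = refl
  ⟨∣⟩-negʳ ((c , u) ∷ p) f rewrite ⟨∣⟩-negʳ p f =
    solve 3 (λ c a x → c :* (:- a) :+ (:- x) := :- (c :* a :+ x)) refl c (f u) ⟨ p ∣ f ⟩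

  ⟨∣⟩--ʳ : ∀ p (f h : W → ℚ) → ⟨ p ∣ (λ u → f u - h u) ⟩ ≡ ⟨ p ∣ f ⟩ - ⟨ p ∣ h ⟩
  ⟨∣⟩--ʳ p f h = trans (⟨∣⟩-+ʳ p f (λ u → - h u)) (cong (⟨ p ∣ f ⟩ +_) (⟨∣⟩-negʳ p h))

  ⟨∣⟩-*-ʳ : ∀ p a (f h : W → ℚ) → ⟨ p ∣ (λ u → a * f u - h u) ⟩ ≡ a * ⟨ p ∣ f ⟩ - ⟨ p ∣ h ⟩
  ⟨∣⟩-*-ʳ p a f h = trans (⟨∣⟩--ʳ p (λ u → a * f u) h) (cong (_- ⟨ p ∣ h ⟩) (⟨∣⟩-*ʳ p a f))

  ⟨∣⟩-++ : ∀ p q (g : W → ℚ) → ⟨ p ++ q ∣ g ⟩ ≡ ⟨ p ∣ g ⟩ + ⟨ q ∣ g ⟩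
  ⟨∣⟩-++ [] q g = sym (+-identityˡ _)
  ⟨∣⟩-++ ((c , u) ∷ p) q g rewrite ⟨∣⟩-++ p q g = sym (+-assoc (c * g u) ⟨ p ∣ g ⟩ ⟨ q ∣ g ⟩)

module _ {V W : Set} where

  ⟨∣⟩-swap : ∀ (p : List (ℚ × V)) (q : List (ℚ × W)) (h : V → W → ℚ) →
             ⟨ p ∣ (λ a → ⟨ q ∣ h a ⟩) ⟩ ≡ ⟨ q ∣ (λ b → ⟨ p ∣ (λ a → h a b) ⟩) ⟩
  ⟨∣⟩-swap [] q h = sym (⟨∣⟩-zeroʳ q)
  ⟨∣⟩-swap ((c , a) ∷ p) q h = begin
      c * ⟨ q ∣ h a ⟩ + ⟨ p ∣ (λ a → ⟨ q ∣ h a ⟩) ⟩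
    ≡⟨ cong₂ _+_ (sym (⟨∣⟩-*ʳ q c (h a))) (⟨∣⟩-swap p q h) ⟩
      ⟨ q ∣ (λ b → c * h a b) ⟩ + ⟨ q ∣ (λ b → ⟨ p ∣ (λ a → h a b) ⟩) ⟩
    ≡⟨ sym (⟨∣⟩-+ʳ q _ _) ⟩
      ⟨ q ∣ (λ b → c * h a b + ⟨ p ∣ (λ a → h a b) ⟩) ⟩ ∎

  ⟨∣⟩-concatMap : ∀ (F : ℚ × V → List (ℚ × W)) (h : V → ℚ) {g : W → ℚ} p →
                  (∀ c a → ⟨ F (c , a) ∣ g ⟩ ≡ c * h a) → ⟨ concatMap F p ∣ g ⟩ ≡ ⟨ p ∣ h ⟩
  ⟨∣⟩-concatMap F h [] eq = refl
  ⟨∣⟩-concatMap F h {g} ((c , a) ∷ p) eq = begin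
      ⟨ F (c , a) ++ concatMap F p ∣ g ⟩
    ≡⟨ ⟨∣⟩-++ (F (c , a)) (concatMap F p) g ⟩
      ⟨ F (c , a) ∣ g ⟩ + ⟨ concatMap F p ∣ g ⟩
    ≡⟨ cong₂ _+_ (eq c a) (⟨∣⟩-concatMap F h p eq) ⟩
      c * h a + ⟨ p ∣ h ⟩ ∎

module _ {r : ℕ} .{{_ : NonZero r}} where

  ⟨∣⟩-word : ∀ u (g : Word r → ℚ) → ⟨ word u ∣ g ⟩ ≡ g u
  ⟨∣⟩-word u g = trans (+-identityʳ _) (*-identityˡ _)

  ⟨∣⟩-neg : ∀ (p : Poly r) g → ⟨ neg p ∣ g ⟩ ≡ - ⟨ p ∣ g ⟩
  ⟨∣⟩-neg [] g = refl
  ⟨∣⟩-neg ((c , u) ∷ p) g rewrite ⟨∣⟩-neg p g =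
    solve 3 (λ c a x → (:- c) :* a :+ (:- x) := :- (c :* a :+ x)) refl c (g u) ⟨ p ∣ g ⟩

  ⟨∣⟩-scale : ∀ k (p : Poly r) g → ⟨ scale k p ∣ g ⟩ ≡ k * ⟨ p ∣ g ⟩
  ⟨∣⟩-scale k [] g = sym (*-zeroʳ k)
  ⟨∣⟩-scale k ((c , u) ∷ p) g rewrite ⟨∣⟩-scale k p g =
    solve 4 (λ k c a x → (k :* c) :* a :+ k :* x := k :* (c :* a :+ x)) refl k c (g u) ⟨ p ∣ g ⟩

  infixl 7 _⊲_
  _⊲_ : (Word r → ℚ) → Letter r → Word r → ℚ
  (g ⊲ a) u = g (u ▷ a)

  ⟨∣⟩-· : ∀ (p : Poly r) a g → ⟨ p · a ∣ g ⟩ ≡ ⟨ p ∣ g ⊲ a ⟩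
  ⟨∣⟩-· [] a g = refl
  ⟨∣⟩-· ((c , u) ∷ p) a g = cong (c * g (u ▷ a) +_) (⟨∣⟩-· p a g)

  ⟨∣⟩-⊖ : ∀ (p q : Poly r) g → ⟨ p ⊖ q ∣ g ⟩ ≡ ⟨ p ∣ g ⟩ - ⟨ q ∣ g ⟩
  ⟨∣⟩-⊖ p q g = trans (⟨∣⟩-++ p (neg q) g) (cong (⟨ p ∣ g ⟩ +_) (⟨∣⟩-neg q g))

  ⟨∣⟩-·⊕· : ∀ (p q : Poly r) a b g → ⟨ p · a ⊕ q · b ∣ g ⟩ ≡ ⟨ p ∣ g ⊲ a ⟩ + ⟨ q ∣ g ⊲ b ⟩
  ⟨∣⟩-·⊕· p q a b g = trans (⟨∣⟩-++ (p · a) (q · b) g) (cong₂ _+_ (⟨∣⟩-· p a g) (⟨∣⟩-· q b g))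

  ⟨∣⟩-·⊖· : ∀ (p q : Poly r) a b g → ⟨ p · a ⊖ q · b ∣ g ⟩ ≡ ⟨ p ∣ g ⊲ a ⟩ - ⟨ q ∣ g ⊲ b ⟩
  ⟨∣⟩-·⊖· p q a b g = trans (⟨∣⟩-⊖ (p · a) (q · b) g) (cong₂ _-_ (⟨∣⟩-· p a g) (⟨∣⟩-· q b g))

  ⟨∣⟩-lin : ∀ (f : Word r → Poly r) p g → ⟨ lin f p ∣ g ⟩ ≡ ⟨ p ∣ (λ u → ⟨ f u ∣ g ⟩) ⟩
  ⟨∣⟩-lin f p g = ⟨∣⟩-concatMap _ _ p (λ c u → ⟨∣⟩-scale c (f u) g)

  ⟨∣⟩-lin₁ : ∀ (f : Word₁ → Poly r) p g → ⟨ lin₁ f p ∣ g ⟩ ≡ ⟨ p ∣ (λ v → ⟨ f v ∣ g ⟩) ⟩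
  ⟨∣⟩-lin₁ f p g = ⟨∣⟩-concatMap _ _ p (λ c v → ⟨∣⟩-scale c (f v) g)

  private
    ⟨∣⟩-scaled-row : ∀ c (f : Word r → Poly r) (q : Poly r) g →
      ⟨ concatMap (λ e → scale (c * proj₁ e) (f (proj₂ e))) q ∣ g ⟩ ≡ c * ⟨ q ∣ (λ w → ⟨ f w ∣ g ⟩) ⟩
    ⟨∣⟩-scaled-row c f q g = trans
      (⟨∣⟩-concatMap _ (λ w → c * ⟨ f w ∣ g ⟩) q (λ d w →
        trans (⟨∣⟩-scale (c * d) (f w) g)
              (solve 3 (λ c d x → (c :* d) :* x := d :* (c :* x)) refl c d ⟨ f w ∣ g ⟩)))
      (⟨∣⟩-*ʳ q c _)

  ⟨∣⟩-bilin : ∀ (f : Word r → Word r → Poly r) p q g →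
              ⟨ bilin f p q ∣ g ⟩ ≡ ⟨ p ∣ (λ a → ⟨ q ∣ (λ b → ⟨ f a b ∣ g ⟩) ⟩) ⟩
  ⟨∣⟩-bilin f p q g = ⟨∣⟩-concatMap _ _ p (λ c a → ⟨∣⟩-scaled-row c (f a) q g)

  ⟨∣⟩-bilin₁ : ∀ (f : Word₁ → Word r → Poly r) p q g →
               ⟨ bilin₁ f p q ∣ g ⟩ ≡ ⟨ p ∣ (λ a → ⟨ q ∣ (λ b → ⟨ f a b ∣ g ⟩) ⟩) ⟩
  ⟨∣⟩-bilin₁ f p q g = ⟨∣⟩-concatMap _ _ p (λ c a → ⟨∣⟩-scaled-row c (f a) q g)

  -- Coefficients determine pairings

  𝟙 : Bool → ℚ
  𝟙 b = if b then 1ℚ else 0ℚ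

  indicator : Word r → Word r → ℚ
  indicator w u = 𝟙 (eqW u w)

  coeff≡⟨∣indicator⟩ : ∀ (p : Poly r) w → coeff p w ≡ ⟨ p ∣ indicator w ⟩
  coeff≡⟨∣indicator⟩ [] w = refl
  coeff≡⟨∣indicator⟩ ((c , u) ∷ p) w = cong₂ _+_ (if≡*𝟙 (eqW u w)) (coeff≡⟨∣indicator⟩ p w)
    where
    if≡*𝟙 : ∀ b → (if b then c else 0ℚ) ≡ c * 𝟙 b
    if≡*𝟙 true = sym (*-identityʳ c)
    if≡*𝟙 false = sym (*-zeroʳ c)

  eqL-refl : ∀ (a : Letter r) → eqL a a ≡ true
  eqL-refl x = refl
  eqL-refl (y i) = dec-true (i Fin.≟ i) refl

  eqW-refl : ∀ (u : Word r) → eqW u u ≡ true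
  eqW-refl ε = refl
  eqW-refl (u ▷ a) rewrite eqW-refl u | eqL-refl a = refl

  eqL-sound : ∀ (a b : Letter r) → eqL a b ≡ true → a ≡ b
  eqL-sound x x _ = refl
  eqL-sound (y i) (y j) eq with i Fin.≟ j
  ... | yes i≡j = cong y i≡j
  eqL-sound x (y _) ()
  eqL-sound (y _) x ()

  eqW-sound : ∀ (u w : Word r) → eqW u w ≡ true → u ≡ w
  eqW-sound ε ε _ = refl
  eqW-sound (u ▷ a) (w ▷ b) eq with eqW u w in eqᵤ | eqL a b in eqₐ
  ... | true | true = cong₂ _▷_ (eqW-sound u w eqᵤ) (eqL-sound a b eqₐ)
  eqW-sound ε (_ ▷ _) ()
  eqW-sound (_ ▷ _) ε ()

  without : Word r → Poly r → Poly r
  without u [] = []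
  without u ((c , w) ∷ p) = if eqW w u then without u p else (c , w) ∷ without u p

  length-without : ∀ u (p : Poly r) → length (without u p) ℕ.≤ length p
  length-without u [] = ℕ.z≤n
  length-without u ((c , w) ∷ p) with eqW w u
  ... | true = ℕ.m≤n⇒m≤1+n (length-without u p)
  ... | false = s≤s (length-without u p)

  without-head : ∀ c u (p : Poly r) → without u ((c , u) ∷ p) ≡ without u p
  without-head c u p rewrite eqW-refl u = refl

  ⟨∣⟩-without : ∀ u (p : Poly r) g → ⟨ p ∣ g ⟩ ≡ coeff p u * g u + ⟨ without u p ∣ g ⟩
  ⟨∣⟩-without u [] g = solve 1 (λ a → con 0ℚ := con 0ℚ :* a :+ con 0ℚ) refl (g u)
  ⟨∣⟩-without u ((c , w) ∷ p) g with eqW w u in eq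
  ... | true rewrite eqW-sound w u eq | ⟨∣⟩-without u p g =
    solve 4 (λ c a k x → c :* a :+ (k :* a :+ x) := (c :+ k) :* a :+ x)
          refl c (g u) (coeff p u) ⟨ without u p ∣ g ⟩
  ... | false rewrite ⟨∣⟩-without u p g =
    solve 5 (λ c b k a x → c :* b :+ (k :* a :+ x) := (con 0ℚ :+ k) :* a :+ (c :* b :+ x))
          refl c (g w) (coeff p u) (g u) ⟨ without u p ∣ g ⟩

  -- n bounds the length: the recursive call drops every occurrence of the head word.
  ⟨∣⟩-vanishes : ∀ n (p : Poly r) g → length p ℕ.≤ n → (∀ w → coeff p w ≡ 0ℚ) → ⟨ p ∣ g ⟩ ≡ 0ℚ
  ⟨∣⟩-vanishes _ [] g _ _ = refl
  ⟨∣⟩-vanishes (suc n) p@((c , u) ∷ q) g (s≤s |q|≤n) coeff≡0 = begin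
      ⟨ p ∣ g ⟩
    ≡⟨ ⟨∣⟩-without u p g ⟩
      coeff p u * g u + ⟨ without u p ∣ g ⟩
    ≡⟨ cong₂ (λ k x → k * g u + x) (coeff≡0 u) rest≡0 ⟩
      0ℚ * g u + 0ℚ
    ≡⟨ solve 1 (λ a → con 0ℚ :* a :+ con 0ℚ := con 0ℚ) refl (g u) ⟩
      0ℚ ∎
    where
    rest-coeff≡0 : ∀ w → coeff (without u p) w ≡ 0ℚ
    rest-coeff≡0 w = begin
        coeff (without u p) w
      ≡⟨ coeff≡⟨∣indicator⟩ (without u p) w ⟩
        ⟨ without u p ∣ indicator w ⟩
      ≡⟨ solve 2 (λ a x → x := con 0ℚ :* a :+ x) refl (indicator w u) _ ⟩
        0ℚ * indicator w u + ⟨ without u p ∣ indicator w ⟩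
      ≡⟨ cong (λ k → k * indicator w u + ⟨ without u p ∣ indicator w ⟩) (sym (coeff≡0 u)) ⟩
        coeff p u * indicator w u + ⟨ without u p ∣ indicator w ⟩
      ≡⟨ sym (⟨∣⟩-without u p (indicator w)) ⟩
        ⟨ p ∣ indicator w ⟩
      ≡⟨ sym (coeff≡⟨∣indicator⟩ p w) ⟩
        coeff p w
      ≡⟨ coeff≡0 w ⟩
        0ℚ ∎
    rest≡0 : ⟨ without u p ∣ g ⟩ ≡ 0ℚ
    rest≡0 = ⟨∣⟩-vanishes n (without u p) g
      (subst (λ p′ → length p′ ℕ.≤ n) (sym (without-head c u q)) (ℕ.≤-trans (length-without u q) |q|≤n))
      rest-coeff≡0

  ⟨∣⟩-resp-≈ : ∀ (p q : Poly r) g → p ≈ q → ⟨ p ∣ g ⟩ ≡ ⟨ q ∣ g ⟩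
  ⟨∣⟩-resp-≈ p q g p≈q = x∙y⁻¹≈ε⇒x≈y ⟨ p ∣ g ⟩ ⟨ q ∣ g ⟩ (begin
      ⟨ p ∣ g ⟩ - ⟨ q ∣ g ⟩
    ≡⟨ sym (⟨∣⟩-⊖ p q g) ⟩
      ⟨ p ⊖ q ∣ g ⟩
    ≡⟨ ⟨∣⟩-vanishes _ (p ⊖ q) g ℕ.≤-refl coeff≡0 ⟩
      0ℚ ∎)
    where
    coeff≡0 : ∀ w → coeff (p ⊖ q) w ≡ 0ℚ
    coeff≡0 w = begin
        coeff (p ⊖ q) w
      ≡⟨ coeff≡⟨∣indicator⟩ (p ⊖ q) w ⟩
        ⟨ p ⊖ q ∣ indicator w ⟩
      ≡⟨ ⟨∣⟩-⊖ p q (indicator w) ⟩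
        ⟨ p ∣ indicator w ⟩ - ⟨ q ∣ indicator w ⟩
      ≡⟨ cong₂ _-_ (sym (coeff≡⟨∣indicator⟩ p w)) (sym (coeff≡⟨∣indicator⟩ q w)) ⟩
        coeff p w - coeff q w
      ≡⟨ cong (_- coeff q w) (p≈q w) ⟩
        coeff q w - coeff q w
      ≡⟨ +-inverseʳ (coeff q w) ⟩
        0ℚ ∎

module _ {r : ℕ} .{{_ : NonZero r}} where

  private
    toℕ-mul : ∀ (i j : Fin r) → toℕ (mul i j) ≡ (toℕ i ℕ.+ toℕ j) % r
    toℕ-mul i j = Fin.toℕ-fromℕ< _

    [m%r+n]%r≡[m+n]%r : ∀ m n → (m % r ℕ.+ n) % r ≡ (m ℕ.+ n) % r
    [m%r+n]%r≡[m+n]%r m n = begin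
        (m % r ℕ.+ n) % r
      ≡⟨ %-distribˡ-+ (m % r) n r ⟩
        (m % r % r ℕ.+ n % r) % r
      ≡⟨ cong (λ k → (k ℕ.+ n % r) % r) (m%n%n≡m%n m r) ⟩
        (m % r ℕ.+ n % r) % r
      ≡⟨ sym (%-distribˡ-+ m n r) ⟩
        (m ℕ.+ n) % r ∎

  mul-comm : ∀ (i j : Fin r) → mul i j ≡ mul j i
  mul-comm i j = Fin.toℕ-injective (begin
      toℕ (mul i j)                 ≡⟨ toℕ-mul i j ⟩
      (toℕ i ℕ.+ toℕ j) % r         ≡⟨ cong (_% r) (ℕ.+-comm (toℕ i) (toℕ j)) ⟩
      (toℕ j ℕ.+ toℕ i) % r         ≡⟨ sym (toℕ-mul j i) ⟩
      toℕ (mul j i)                 ∎)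

  mul-identityˡ : ∀ (i : Fin r) → mul one i ≡ i
  mul-identityˡ i = Fin.toℕ-injective (begin
      toℕ (mul one i)               ≡⟨ toℕ-mul one i ⟩
      (toℕ (one {r}) ℕ.+ toℕ i) % r ≡⟨ cong (λ k → (k ℕ.+ toℕ i) % r) (Fin.toℕ-fromℕ< _) ⟩
      (0 % r ℕ.+ toℕ i) % r         ≡⟨ [m%r+n]%r≡[m+n]%r 0 (toℕ i) ⟩
      toℕ i % r                     ≡⟨ m<n⇒m%n≡m (Fin.toℕ<n i) ⟩
      toℕ i                         ∎)

  mul-assoc : ∀ (i j k : Fin r) → mul (mul i j) k ≡ mul i (mul j k)
  mul-assoc i j k = Fin.toℕ-injective (begin
      toℕ (mul (mul i j) k)                ≡⟨ toℕ-mul (mul i j) k ⟩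
      (toℕ (mul i j) ℕ.+ toℕ k) % r        ≡⟨ cong (λ m → (m ℕ.+ toℕ k) % r) (toℕ-mul i j) ⟩
      ((toℕ i ℕ.+ toℕ j) % r ℕ.+ toℕ k) % r ≡⟨ [m%r+n]%r≡[m+n]%r (toℕ i ℕ.+ toℕ j) (toℕ k) ⟩
      (toℕ i ℕ.+ toℕ j ℕ.+ toℕ k) % r      ≡⟨ cong (_% r) (ℕ.+-assoc (toℕ i) (toℕ j) (toℕ k)) ⟩
      (toℕ i ℕ.+ (toℕ j ℕ.+ toℕ k)) % r    ≡⟨ cong (_% r) (ℕ.+-comm (toℕ i) _) ⟩
      (toℕ j ℕ.+ toℕ k ℕ.+ toℕ i) % r      ≡⟨ sym ([m%r+n]%r≡[m+n]%r (toℕ j ℕ.+ toℕ k) (toℕ i)) ⟩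
      ((toℕ j ℕ.+ toℕ k) % r ℕ.+ toℕ i) % r ≡⟨ cong (λ m → (m ℕ.+ toℕ i) % r) (sym (toℕ-mul j k)) ⟩
      (toℕ (mul j k) ℕ.+ toℕ i) % r        ≡⟨ sym (toℕ-mul (mul j k) i) ⟩
      toℕ (mul (mul j k) i)                ≡⟨ cong toℕ (mul-comm (mul j k) i) ⟩
      toℕ (mul i (mul j k))                ∎)

  μ-commutativeMonoid : CommutativeMonoid 0ℓ 0ℓ
  μ-commutativeMonoid = record
    { Carrier = Fin r
    ; _≈_ = _≡_
    ; _∙_ = mul
    ; ε = one
    ; isCommutativeMonoid = Biased.isCommutativeMonoidˡ record
      { isSemigroup = record
        { isMagma = record { isEquivalence = isEquivalence ; ∙-cong = cong₂ mul }
        ; assoc = mul-assoc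
        }
      ; identityˡ = mul-identityˡ
      ; comm = mul-comm
      }
    }

  open CMSolver μ-commutativeMonoid public
    using (_⊜_) renaming (solve to μ-solve; _⊕_ to _⊛_; id to ι)

  -- φ and the harmonic product on index products

  isOne-one : isOne (one {r}) ≡ true
  isOne-one = dec-true (one Fin.≟ one) refl

  δ : Fin r → ℚ
  δ c = if isOne c then 0ℚ else 1ℚ

  φᵀy : Fin r → (Word r → ℚ) → Word r → ℚ
  φᵀy c g u = δ c * g (u ▷ y c) - g (u ▷ y1)

  ⟨∣⟩-φW-y : ∀ w c g → ⟨ φW (w ▷ y c) ∣ g ⟩ ≡ ⟨ φW w ∣ φᵀy c g ⟩
  ⟨∣⟩-φW-y w c g = trans (by-cases (isOne c)) (sym (⟨∣⟩-*-ʳ (φW w) (δ c) _ _))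
    where
    A = φW w
    by-cases : ∀ b → ⟨ if b then neg (A · y1) else (A · y c ⊖ A · y1) ∣ g ⟩
                     ≡ (if b then 0ℚ else 1ℚ) * ⟨ A ∣ g ⊲ y c ⟩ - ⟨ A ∣ g ⊲ y1 ⟩
    by-cases true = begin
        ⟨ neg (A · y1) ∣ g ⟩
      ≡⟨ trans (⟨∣⟩-neg (A · y1) g) (cong -_ (⟨∣⟩-· A y1 g)) ⟩
        - ⟨ A ∣ g ⊲ y1 ⟩
      ≡⟨ solve 2 (λ a b → :- b := con 0ℚ :* a :- b) refl ⟨ A ∣ g ⊲ y c ⟩ ⟨ A ∣ g ⊲ y1 ⟩ ⟩
        0ℚ * ⟨ A ∣ g ⊲ y c ⟩ - ⟨ A ∣ g ⊲ y1 ⟩ ∎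
    by-cases false = begin
        ⟨ A · y c ⊖ A · y1 ∣ g ⟩
      ≡⟨ ⟨∣⟩-·⊖· A A (y c) y1 g ⟩
        ⟨ A ∣ g ⊲ y c ⟩ - ⟨ A ∣ g ⊲ y1 ⟩
      ≡⟨ cong (_- ⟨ A ∣ g ⊲ y1 ⟩) (sym (*-identityˡ ⟨ A ∣ g ⊲ y c ⟩)) ⟩
        1ℚ * ⟨ A ∣ g ⊲ y c ⟩ - ⟨ A ∣ g ⊲ y1 ⟩ ∎

  Homogeneous : Fin r → Poly r → Set
  Homogeneous π = All (λ e → prodY (proj₂ e) ≡ π)

  ·x-homogeneous : ∀ {π} {p : Poly r} → Homogeneous π p → Homogeneous π (p · x)
  ·x-homogeneous = All.map⁺

  ·y-homogeneous : ∀ {π π′} t {p : Poly r} → mul π t ≡ π′ → Homogeneous π p → Homogeneous π′ (p · y t)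
  ·y-homogeneous t eq hom = All.map⁺ (All.map (λ πq → trans (cong (λ π → mul π t) πq) eq) hom)

  φ₁W : Word₁ → Poly r
  φ₁W v = φW (embW v)

  φ₁W-y : ∀ v → φ₁W (v ▷₁ y₁) ≡ neg (φ₁W v · y1)
  φ₁W-y v rewrite isOne-one = refl

  φ₁W-homogeneous : ∀ v → Homogeneous one (φ₁W v)
  φ₁W-homogeneous ε₁ = refl ∷ []
  φ₁W-homogeneous (v ▷₁ x₁) =
    All.++⁺ (·x-homogeneous (φ₁W-homogeneous v)) (·y-homogeneous one (mul-identityˡ one) (φ₁W-homogeneous v))
  φ₁W-homogeneous (v ▷₁ y₁) rewrite φ₁W-y v =
    All.map⁺ (·y-homogeneous one (mul-identityˡ one) (φ₁W-homogeneous v))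

  harmW-ε : ∀ (p : Word r) → harmW p ε ≡ word p
  harmW-ε ε = refl
  harmW-ε (p ▷ a) = refl

  harmW-▷x : ∀ (p u : Word r) → harmW (p ▷ x) u ≡ harmW p u · x
  harmW-▷x p ε rewrite harmW-ε p = refl
  harmW-▷x p (u ▷ a) = refl

  harmW-x◁ : ∀ (p u : Word r) → harmW p (u ▷ x) ≡ harmW p u · x
  harmW-x◁ ε u = refl
  harmW-x◁ (p ▷ x) u = cong (_· x) (trans (harmW-x◁ p u) (sym (harmW-▷x p u)))
  harmW-x◁ (p ▷ y t) u = refl

  harmW-homogeneous : ∀ (p u : Word r) → Homogeneous (mul (prodY p) (prodY u)) (harmW p u)
  harmW-homogeneous ε u = sym (mul-identityˡ (prodY u)) ∷ []
  harmW-homogeneous (p ▷ a) ε = μ-solve 1 (λ π → π ⊜ π ⊛ ι) refl (prodY (p ▷ a)) ∷ []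
  harmW-homogeneous (p ▷ x) (u ▷ b) = ·x-homogeneous (harmW-homogeneous p (u ▷ b))
  harmW-homogeneous (p ▷ y s) (u ▷ x) = ·x-homogeneous (harmW-homogeneous (p ▷ y s) u)
  harmW-homogeneous (p ▷ y s) (u ▷ y t) =
    All.++⁺ (All.++⁺ (·y-homogeneous s e₁ (harmW-homogeneous p (u ▷ y t)))
                     (·y-homogeneous t e₂ (harmW-homogeneous (p ▷ y s) u)))
            (·y-homogeneous (mul s t) e₃ (·x-homogeneous (harmW-homogeneous p u)))
    where
    π = prodY p
    ρ = prodY u
    e₁ : mul (mul π (mul ρ t)) s ≡ mul (mul π s) (mul ρ t)
    e₁ = μ-solve 4 (λ π ρ s t → (π ⊛ (ρ ⊛ t)) ⊛ s ⊜ (π ⊛ s) ⊛ (ρ ⊛ t)) refl π ρ s t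
    e₂ : mul (mul (mul π s) ρ) t ≡ mul (mul π s) (mul ρ t)
    e₂ = μ-solve 4 (λ π ρ s t → ((π ⊛ s) ⊛ ρ) ⊛ t ⊜ (π ⊛ s) ⊛ (ρ ⊛ t)) refl π ρ s t
    e₃ : mul (mul π ρ) (mul s t) ≡ mul (mul π s) (mul ρ t)
    e₃ = μ-solve 4 (λ π ρ s t → (π ⊛ ρ) ⊛ (s ⊛ t) ⊜ (π ⊛ s) ⊛ (ρ ⊛ t)) refl π ρ s t

-- ψ_s and the right-hand side ψ_s(φ(v) ∗ u)

module _ {r : ℕ} .{{_ : NonZero r}} (s : Fin r) where

  private
    MW-noY : ∀ (u : Word r) → hasY u ≡ false → MW s u ≡ u
    MW-noY ε _ = refl
    MW-noY (u ▷ x) noY = cong (_▷ x) (MW-noY u noY)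

    prodY-noY : ∀ (u : Word r) → hasY u ≡ false → prodY u ≡ one
    prodY-noY ε _ = refl
    prodY-noY (u ▷ x) noY = prodY-noY u noY

    prodY-MW : ∀ (u : Word r) → hasY u ≡ true → prodY (MW s u) ≡ mul s (prodY u)
    prodY-MW (u ▷ x) hasY-u = prodY-MW u hasY-u
    prodY-MW (u ▷ y t) _ with hasY u in hasY-u
    ... | true = trans (cong (λ π → mul π t) (prodY-MW u hasY-u)) (mul-assoc s (prodY u) t)
    ... | false rewrite prodY-noY u hasY-u = μ-solve 2 (λ s t → ι ⊛ (s ⊛ t) ⊜ s ⊛ (ι ⊛ t)) refl s t

  𝓘W-MW-y : ∀ (u : Word r) t → 𝓘W (MW s (u ▷ y t)) ≡ 𝓘W (MW s u) ▷ y (mul s (mul (prodY u) t))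
  𝓘W-MW-y u t with hasY u in hasY-u
  ... | true = cong (λ c → 𝓘W (MW s u) ▷ y c)
                    (trans (cong (λ π → mul π t) (prodY-MW u hasY-u)) (mul-assoc s (prodY u) t))
  ... | false rewrite MW-noY u hasY-u | prodY-noY u hasY-u =
    cong (λ c → 𝓘W u ▷ y c) (μ-solve 2 (λ s t → ι ⊛ (s ⊛ t) ⊜ s ⊛ (ι ⊛ t)) refl s t)

  ψW : Word r → Poly r
  ψW u = φW (𝓘W (MW s u))

  ψᵀ : (Word r → ℚ) → Word r → ℚ
  ψᵀ g u = ⟨ ψW u ∣ g ⟩

  ψᵀ-x : ∀ g u → ψᵀ g (u ▷ x) ≡ ψᵀ (g ⊲ x) u + ψᵀ (g ⊲ y1) u
  ψᵀ-x g u = ⟨∣⟩-·⊕· (ψW u) (ψW u) x y1 g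

  ψᵀ-y : ∀ g u t → ψᵀ g (u ▷ y t) ≡ ψᵀ (φᵀy (mul s (mul (prodY u) t)) g) u
  ψᵀ-y g u t =
    trans (cong (λ w → ⟨ φW w ∣ g ⟩) (𝓘W-MW-y u t)) (⟨∣⟩-φW-y (𝓘W (MW s u)) (mul s (mul (prodY u) t)) g)

  ψW-y-one : ∀ u t → isOne (mul s (mul (prodY u) t)) ≡ true → ψW (u ▷ y t) ≡ neg (ψW u · y1)
  ψW-y-one u t c≡1 = trans (cong φW (𝓘W-MW-y u t)) (φW-y (isOne c) c≡1)
    where
    c = mul s (mul (prodY u) t)
    φW-y : ∀ b → b ≡ true → (if b then neg (ψW u · y1) else (ψW u · y c ⊖ ψW u · y1)) ≡ neg (ψW u · y1)
    φW-y b refl = refl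

  ψW-y-other : ∀ u t → let c = mul s (mul (prodY u) t) in
               isOne c ≡ false → ψW (u ▷ y t) ≡ ψW u · y c ⊖ ψW u · y1
  ψW-y-other u t c≢1 = trans (cong φW (𝓘W-MW-y u t)) (φW-y (isOne c) c≢1)
    where
    c = mul s (mul (prodY u) t)
    φW-y : ∀ b → b ≡ false → (if b then neg (ψW u · y1) else (ψW u · y c ⊖ ψW u · y1)) ≡ ψW u · y c ⊖ ψW u · y1
    φW-y b refl = refl

  ⟨∣⟩-ψᵀ⊲y : ∀ {π c} t {Z : Poly r} g → mul s (mul π t) ≡ c → Homogeneous π Z →
            ⟨ Z ∣ ψᵀ g ⊲ y t ⟩ ≡ ⟨ Z ∣ ψᵀ (φᵀy c g) ⟩
  ⟨∣⟩-ψᵀ⊲y t g eq hom = ⟨∣⟩-congʳ-on hom (λ q πq →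
    trans (ψᵀ-y g q t) (cong (λ π → ψᵀ (φᵀy π g) q) (trans (cong (λ π → mul s (mul π t)) πq) eq)))

  -- ψφ∗ v u g is the pairing ⟨ ψ_s(φ(v) ∗ u) ∣ g ⟩.
  ψφ∗ : Word₁ → Word r → (Word r → ℚ) → ℚ
  ψφ∗ v u g = ⟨ φ₁W v ∣ (λ p → ⟨ harmW p u ∣ ψᵀ g ⟩) ⟩

  ψφ∗-ε₁ : ∀ u g → ψφ∗ ε₁ u g ≡ ψᵀ g u
  ψφ∗-ε₁ u g = trans (⟨∣⟩-word ε (λ p → ⟨ harmW p u ∣ ψᵀ g ⟩)) (⟨∣⟩-word u (ψᵀ g))

  ψφ∗-ε : ∀ v g → ψφ∗ v ε g ≡ ⟨ φ₁W v ∣ ψᵀ g ⟩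
  ψφ∗-ε v g = ⟨∣⟩-congʳ (φ₁W v) (λ p → trans (cong (λ Z → ⟨ Z ∣ ψᵀ g ⟩) (harmW-ε p)) (⟨∣⟩-word p (ψᵀ g)))

  ψφ∗-x : ∀ v u g → ψφ∗ v (u ▷ x) g ≡ ψφ∗ v u (g ⊲ x) + ψφ∗ v u (g ⊲ y1)
  ψφ∗-x v u g = trans (⟨∣⟩-congʳ (φ₁W v) harm-x) (⟨∣⟩-+ʳ (φ₁W v) _ _)
    where
    harm-x : ∀ p → ⟨ harmW p (u ▷ x) ∣ ψᵀ g ⟩ ≡ ⟨ harmW p u ∣ ψᵀ (g ⊲ x) ⟩ + ⟨ harmW p u ∣ ψᵀ (g ⊲ y1) ⟩
    harm-x p = begin
        ⟨ harmW p (u ▷ x) ∣ ψᵀ g ⟩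
      ≡⟨ cong (λ Z → ⟨ Z ∣ ψᵀ g ⟩) (harmW-x◁ p u) ⟩
        ⟨ harmW p u · x ∣ ψᵀ g ⟩
      ≡⟨ ⟨∣⟩-· (harmW p u) x (ψᵀ g) ⟩
        ⟨ harmW p u ∣ ψᵀ g ⊲ x ⟩
      ≡⟨ ⟨∣⟩-congʳ (harmW p u) (ψᵀ-x g) ⟩
        ⟨ harmW p u ∣ (λ q → ψᵀ (g ⊲ x) q + ψᵀ (g ⊲ y1) q) ⟩
      ≡⟨ ⟨∣⟩-+ʳ (harmW p u) _ _ ⟩
        ⟨ harmW p u ∣ ψᵀ (g ⊲ x) ⟩ + ⟨ harmW p u ∣ ψᵀ (g ⊲ y1) ⟩ ∎

  ψφ∗-▷y : ∀ v u g → ψφ∗ (v ▷₁ y₁) u g ≡ - ⟨ φ₁W v ∣ (λ p → ⟨ harmW (p ▷ y1) u ∣ ψᵀ g ⟩) ⟩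
  ψφ∗-▷y v u g = begin
      ⟨ φ₁W (v ▷₁ y₁) ∣ (λ p → ⟨ harmW p u ∣ ψᵀ g ⟩) ⟩
    ≡⟨ cong (λ Z → ⟨ Z ∣ (λ p → ⟨ harmW p u ∣ ψᵀ g ⟩) ⟩) (φ₁W-y v) ⟩
      ⟨ neg (φ₁W v · y1) ∣ (λ p → ⟨ harmW p u ∣ ψᵀ g ⟩) ⟩
    ≡⟨ ⟨∣⟩-neg (φ₁W v · y1) _ ⟩
      - ⟨ φ₁W v · y1 ∣ (λ p → ⟨ harmW p u ∣ ψᵀ g ⟩) ⟩
    ≡⟨ cong -_ (⟨∣⟩-· (φ₁W v) y1 _) ⟩
      - ⟨ φ₁W v ∣ (λ p → ⟨ harmW (p ▷ y1) u ∣ ψᵀ g ⟩) ⟩ ∎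

  ψφ∗-z : ∀ v u g → ψφ∗ (v ▷₁ x₁) u g + ψφ∗ (v ▷₁ y₁) u g ≡ ψφ∗ v (u ▷ x) g
  ψφ∗-z v u g = begin
      ⟨ A · x ⊕ A · y1 ∣ H ⟩ + ψφ∗ (v ▷₁ y₁) u g
    ≡⟨ cong₂ _+_ (⟨∣⟩-·⊕· A A x y1 H) (ψφ∗-▷y v u g) ⟩
      ⟨ A ∣ H ⊲ x ⟩ + ⟨ A ∣ H ⊲ y1 ⟩ + - ⟨ A ∣ H ⊲ y1 ⟩
    ≡⟨ solve 2 (λ a b → a :+ b :+ :- b := a) refl ⟨ A ∣ H ⊲ x ⟩ ⟨ A ∣ H ⊲ y1 ⟩ ⟩
      ⟨ A ∣ H ⊲ x ⟩
    ≡⟨ ⟨∣⟩-congʳ A (λ p → cong (λ Z → ⟨ Z ∣ ψᵀ g ⟩) (trans (harmW-▷x p u) (sym (harmW-x◁ p u)))) ⟩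
      ψφ∗ v (u ▷ x) g ∎
    where
    A = φ₁W v
    H = λ p → ⟨ harmW p u ∣ ψᵀ g ⟩

  ψφ∗-φᵀy : ∀ v u c g → ψφ∗ v u (φᵀy c g) ≡ δ c * ψφ∗ v u (g ⊲ y c) - ψφ∗ v u (g ⊲ y1)
  ψφ∗-φᵀy v u c g = trans
    (⟨∣⟩-congʳ (φ₁W v) (λ p → trans (⟨∣⟩-congʳ (harmW p u) (λ q → ⟨∣⟩-*-ʳ (ψW q) (δ c) _ _))
                                   (⟨∣⟩-*-ʳ (harmW p u) (δ c) _ _)))
    (⟨∣⟩-*-ʳ (φ₁W v) (δ c) _ _)

  ψφ∗-y : ∀ v u t g → let h = φᵀy (mul s (mul (prodY u) t)) g in
          ψφ∗ (v ▷₁ y₁) (u ▷ y t) g ≡ ψφ∗ (v ▷₁ y₁) u h - ψφ∗ v (u ▷ y t) h - ψφ∗ v (u ▷ x) h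
  ψφ∗-y v u t g = begin
      ψφ∗ (v ▷₁ y₁) (u ▷ y t) g
    ≡⟨ ψφ∗-▷y v (u ▷ y t) g ⟩
      - ⟨ A ∣ (λ p → ⟨ harmW (p ▷ y1) (u ▷ y t) ∣ ψᵀ g ⟩) ⟩
    ≡⟨ cong -_ (⟨∣⟩-congʳ-on (φ₁W-homogeneous v) harm-y) ⟩
      - ⟨ A ∣ (λ p → ⟨ harmW p (u ▷ y t) ∣ ψᵀ h ⟩ + ⟨ harmW (p ▷ y1) u ∣ ψᵀ h ⟩ + ⟨ harmW p (u ▷ x) ∣ ψᵀ h ⟩) ⟩
    ≡⟨ cong -_ (trans (⟨∣⟩-+ʳ A _ _) (cong (_+ ψφ∗ v (u ▷ x) h) (⟨∣⟩-+ʳ A _ _))) ⟩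
      - (ψφ∗ v (u ▷ y t) h + Yu + ψφ∗ v (u ▷ x) h)
    ≡⟨ solve 3 (λ a b c → :- (a :+ b :+ c) := (:- b) :- a :- c) refl (ψφ∗ v (u ▷ y t) h) Yu (ψφ∗ v (u ▷ x) h) ⟩
      - Yu - ψφ∗ v (u ▷ y t) h - ψφ∗ v (u ▷ x) h
    ≡⟨ cong (λ a → a - ψφ∗ v (u ▷ y t) h - ψφ∗ v (u ▷ x) h) (sym (ψφ∗-▷y v u h)) ⟩
      ψφ∗ (v ▷₁ y₁) u h - ψφ∗ v (u ▷ y t) h - ψφ∗ v (u ▷ x) h ∎
    where
    A = φ₁W v
    c = mul s (mul (prodY u) t)
    h = φᵀy c g
    Yu = ⟨ A ∣ (λ p → ⟨ harmW (p ▷ y1) u ∣ ψᵀ h ⟩) ⟩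
    harm-y : ∀ p → prodY p ≡ one →
             ⟨ harmW (p ▷ y1) (u ▷ y t) ∣ ψᵀ g ⟩
             ≡ ⟨ harmW p (u ▷ y t) ∣ ψᵀ h ⟩ + ⟨ harmW (p ▷ y1) u ∣ ψᵀ h ⟩ + ⟨ harmW p (u ▷ x) ∣ ψᵀ h ⟩
    harm-y p πp = begin
        ⟨ T · y1 ⊕ U · y t ⊕ V · x · y (mul one t) ∣ ψᵀ g ⟩
      ≡⟨ trans (⟨∣⟩-++ (T · y1 ⊕ U · y t) _ (ψᵀ g))
               (cong (_+ ⟨ V · x · y (mul one t) ∣ ψᵀ g ⟩) (⟨∣⟩-++ (T · y1) (U · y t) (ψᵀ g))) ⟩
        ⟨ T · y1 ∣ ψᵀ g ⟩ + ⟨ U · y t ∣ ψᵀ g ⟩ + ⟨ V · x · y (mul one t) ∣ ψᵀ g ⟩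
      ≡⟨ cong₂ _+_ (cong₂ _+_ (⟨∣⟩-· T y1 (ψᵀ g)) (⟨∣⟩-· U (y t) (ψᵀ g))) (⟨∣⟩-· (V · x) (y (mul one t)) (ψᵀ g)) ⟩
        ⟨ T ∣ ψᵀ g ⊲ y1 ⟩ + ⟨ U ∣ ψᵀ g ⊲ y t ⟩ + ⟨ V · x ∣ ψᵀ g ⊲ y (mul one t) ⟩
      ≡⟨ cong₂ _+_ (cong₂ _+_ (⟨∣⟩-ψᵀ⊲y one g e₁ T-hom) (⟨∣⟩-ψᵀ⊲y t g e₂ U-hom))
                   (⟨∣⟩-ψᵀ⊲y (mul one t) g e₃ (·x-homogeneous V-hom)) ⟩
        ⟨ T ∣ ψᵀ h ⟩ + ⟨ U ∣ ψᵀ h ⟩ + ⟨ V · x ∣ ψᵀ h ⟩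
      ≡⟨ cong (λ Z → ⟨ T ∣ ψᵀ h ⟩ + ⟨ U ∣ ψᵀ h ⟩ + ⟨ Z ∣ ψᵀ h ⟩) (sym (harmW-x◁ p u)) ⟩
        ⟨ T ∣ ψᵀ h ⟩ + ⟨ U ∣ ψᵀ h ⟩ + ⟨ harmW p (u ▷ x) ∣ ψᵀ h ⟩ ∎
      where
      ρ = prodY u
      T = harmW p (u ▷ y t)
      U = harmW (p ▷ y1) u
      V = harmW p u
      T-hom : Homogeneous (mul one (mul ρ t)) T
      T-hom = subst (λ π → Homogeneous (mul π (mul ρ t)) T) πp (harmW-homogeneous p (u ▷ y t))
      U-hom : Homogeneous (mul (mul one one) ρ) U
      U-hom = subst (λ π → Homogeneous (mul (mul π one) ρ) U) πp (harmW-homogeneous (p ▷ y1) u)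
      V-hom : Homogeneous (mul one ρ) V
      V-hom = subst (λ π → Homogeneous (mul π ρ) V) πp (harmW-homogeneous p u)
      e₁ : mul s (mul (mul one (mul ρ t)) one) ≡ c
      e₁ = μ-solve 3 (λ σ ρ t → σ ⊛ ((ι ⊛ (ρ ⊛ t)) ⊛ ι) ⊜ σ ⊛ (ρ ⊛ t)) refl s ρ t
      e₂ : mul s (mul (mul (mul one one) ρ) t) ≡ c
      e₂ = μ-solve 3 (λ σ ρ t → σ ⊛ (((ι ⊛ ι) ⊛ ρ) ⊛ t) ⊜ σ ⊛ (ρ ⊛ t)) refl s ρ t
      e₃ : mul s (mul (mul one ρ) (mul one t)) ≡ c
      e₃ = μ-solve 3 (λ σ ρ t → σ ⊛ ((ι ⊛ ρ) ⊛ (ι ⊛ t)) ⊜ σ ⊛ (ρ ⊛ t)) refl s ρ t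

  -- The diamond product

  ◇ᵀ : Word₁ → (Word r → ℚ) → Word r → ℚ
  ◇ᵀ v g q = ⟨ diaW s v q ∣ g ⟩

  ◇ᵀ-ε : ∀ v g → ◇ᵀ v g ε ≡ ⟨ φ₁W v ∣ ψᵀ g ⟩
  ◇ᵀ-ε ε₁ g = sym (⟨∣⟩-word ε (ψᵀ g))
  ◇ᵀ-ε (v ▷₁ a) g = begin
      ⟨ ψ s (φ₁ ((1ℚ , v ▷₁ a) ∷ [])) ∣ g ⟩
    ≡⟨ ⟨∣⟩-lin ψW (φ₁ ((1ℚ , v ▷₁ a) ∷ [])) g ⟩
      ⟨ φ₁ ((1ℚ , v ▷₁ a) ∷ []) ∣ ψᵀ g ⟩
    ≡⟨ ⟨∣⟩-lin₁ φ₁W ((1ℚ , v ▷₁ a) ∷ []) (ψᵀ g) ⟩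
      1ℚ * ⟨ φ₁W (v ▷₁ a) ∣ ψᵀ g ⟩ + 0ℚ
    ≡⟨ trans (+-identityʳ _) (*-identityˡ _) ⟩
      ⟨ φ₁W (v ▷₁ a) ∣ ψᵀ g ⟩ ∎

  ◇ᵀ-z : ∀ v g q → ◇ᵀ (v ▷₁ x₁) g q + ◇ᵀ (v ▷₁ y₁) g q ≡ ◇ᵀ v (g ⊲ x) q + ◇ᵀ v (g ⊲ y1) q
  ◇ᵀ-z v g ε = begin
      ◇ᵀ (v ▷₁ x₁) g ε + ◇ᵀ (v ▷₁ y₁) g ε
    ≡⟨ cong₂ _+_ (trans (◇ᵀ-ε (v ▷₁ x₁) g) (sym (ψφ∗-ε (v ▷₁ x₁) g)))
                 (trans (◇ᵀ-ε (v ▷₁ y₁) g) (sym (ψφ∗-ε (v ▷₁ y₁) g))) ⟩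
      ψφ∗ (v ▷₁ x₁) ε g + ψφ∗ (v ▷₁ y₁) ε g
    ≡⟨ trans (ψφ∗-z v ε g) (ψφ∗-x v ε g) ⟩
      ψφ∗ v ε (g ⊲ x) + ψφ∗ v ε (g ⊲ y1)
    ≡⟨ cong₂ _+_ (trans (ψφ∗-ε v (g ⊲ x)) (sym (◇ᵀ-ε v (g ⊲ x))))
                 (trans (ψφ∗-ε v (g ⊲ y1)) (sym (◇ᵀ-ε v (g ⊲ y1)))) ⟩
      ◇ᵀ v (g ⊲ x) ε + ◇ᵀ v (g ⊲ y1) ε ∎
  ◇ᵀ-z v g (q ▷ x) = begin
      ⟨ A · x ⊖ B · x ∣ g ⟩ + ⟨ A · y1 ⊕ B · x ∣ g ⟩
    ≡⟨ cong₂ _+_ (⟨∣⟩-·⊖· A B x x g) (⟨∣⟩-·⊕· A B y1 x g) ⟩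
      ⟨ A ∣ g ⊲ x ⟩ - ⟨ B ∣ g ⊲ x ⟩ + (⟨ A ∣ g ⊲ y1 ⟩ + ⟨ B ∣ g ⊲ x ⟩)
    ≡⟨ solve 3 (λ a b c → a :- b :+ (c :+ b) := a :+ c) refl ⟨ A ∣ g ⊲ x ⟩ ⟨ B ∣ g ⊲ x ⟩ ⟨ A ∣ g ⊲ y1 ⟩ ⟩
      ⟨ A ∣ g ⊲ x ⟩ + ⟨ A ∣ g ⊲ y1 ⟩ ∎
    where
    A = diaW s v (q ▷ x)
    B = diaD s v y₁ q
  ◇ᵀ-z v g (q ▷ y t) with isOne t
  ... | true = begin
      ⟨ A · x ⊕ C · y1 ∣ g ⟩ + ⟨ A · y1 ⊖ C · y1 ∣ g ⟩
    ≡⟨ cong₂ _+_ (⟨∣⟩-·⊕· A C x y1 g) (⟨∣⟩-·⊖· A C y1 y1 g) ⟩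
      ⟨ A ∣ g ⊲ x ⟩ + ⟨ C ∣ g ⊲ y1 ⟩ + (⟨ A ∣ g ⊲ y1 ⟩ - ⟨ C ∣ g ⊲ y1 ⟩)
    ≡⟨ solve 3 (λ a c b → a :+ c :+ (b :- c) := a :+ b) refl ⟨ A ∣ g ⊲ x ⟩ ⟨ C ∣ g ⊲ y1 ⟩ ⟨ A ∣ g ⊲ y1 ⟩ ⟩
      ⟨ A ∣ g ⊲ x ⟩ + ⟨ A ∣ g ⊲ y1 ⟩ ∎
    where
    A = diaW s v (q ▷ y t)
    C = diaD s v x₁ q
  ... | false = begin
      ⟨ A · x ⊕ M · y t ⊖ B · y t ∣ g ⟩ + ⟨ A · y1 ⊖ M · y t ⊕ B · y t ∣ g ⟩
    ≡⟨ cong₂ _+_ (trans (⟨∣⟩-⊖ (A · x ⊕ M · y t) (B · y t) g)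
                        (cong₂ _-_ (⟨∣⟩-·⊕· A M x (y t) g) (⟨∣⟩-· B (y t) g)))
                 (trans (⟨∣⟩-++ (A · y1 ⊖ M · y t) (B · y t) g)
                        (cong₂ _+_ (⟨∣⟩-·⊖· A M y1 (y t) g) (⟨∣⟩-· B (y t) g))) ⟩
      ⟨ A ∣ g ⊲ x ⟩ + ⟨ M ∣ g ⊲ y t ⟩ - ⟨ B ∣ g ⊲ y t ⟩ + (⟨ A ∣ g ⊲ y1 ⟩ - ⟨ M ∣ g ⊲ y t ⟩ + ⟨ B ∣ g ⊲ y t ⟩)
    ≡⟨ solve 4 (λ a m b c → a :+ m :- b :+ (c :- m :+ b) := a :+ c) refl
               ⟨ A ∣ g ⊲ x ⟩ ⟨ M ∣ g ⊲ y t ⟩ ⟨ B ∣ g ⊲ y t ⟩ ⟨ A ∣ g ⊲ y1 ⟩ ⟩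
      ⟨ A ∣ g ⊲ x ⟩ + ⟨ A ∣ g ⊲ y1 ⟩ ∎
    where
    A = diaW s v (q ▷ y t)
    M = diaW s v (q ▷ x) ⊕ diaW s v (q ▷ y t)
    B = diaD s v y₁ q

  ⟨∣⟩-◇ᵀ-z : ∀ v (P : Poly r) g →
            ⟨ P ∣ ◇ᵀ (v ▷₁ x₁) g ⟩ + ⟨ P ∣ ◇ᵀ (v ▷₁ y₁) g ⟩ ≡ ⟨ P ∣ ◇ᵀ v (g ⊲ x) ⟩ + ⟨ P ∣ ◇ᵀ v (g ⊲ y1) ⟩
  ⟨∣⟩-◇ᵀ-z v P g = trans (sym (⟨∣⟩-+ʳ P _ _)) (trans (⟨∣⟩-congʳ P (◇ᵀ-z v g)) (⟨∣⟩-+ʳ P _ _))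

  ◇ᵀ-y·x : ∀ v (P : Poly r) g →
           ⟨ P · x ∣ ◇ᵀ (v ▷₁ y₁) g ⟩ ≡ ⟨ P · x ∣ ◇ᵀ v (g ⊲ y1) ⟩ + ⟨ P ∣ ◇ᵀ (v ▷₁ y₁) (g ⊲ x) ⟩
  ◇ᵀ-y·x v P g = begin
      ⟨ P · x ∣ ◇ᵀ (v ▷₁ y₁) g ⟩
    ≡⟨ ⟨∣⟩-· P x _ ⟩
      ⟨ P ∣ ◇ᵀ (v ▷₁ y₁) g ⊲ x ⟩
    ≡⟨ ⟨∣⟩-congʳ P (λ q → ⟨∣⟩-·⊕· (diaW s v (q ▷ x)) (diaD s v y₁ q) y1 x g) ⟩
      ⟨ P ∣ (λ q → ◇ᵀ v (g ⊲ y1) (q ▷ x) + ◇ᵀ (v ▷₁ y₁) (g ⊲ x) q) ⟩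
    ≡⟨ ⟨∣⟩-+ʳ P _ _ ⟩
      ⟨ P ∣ ◇ᵀ v (g ⊲ y1) ⊲ x ⟩ + ⟨ P ∣ ◇ᵀ (v ▷₁ y₁) (g ⊲ x) ⟩
    ≡⟨ cong (_+ ⟨ P ∣ ◇ᵀ (v ▷₁ y₁) (g ⊲ x) ⟩) (sym (⟨∣⟩-· P x _)) ⟩
      ⟨ P · x ∣ ◇ᵀ v (g ⊲ y1) ⟩ + ⟨ P ∣ ◇ᵀ (v ▷₁ y₁) (g ⊲ x) ⟩ ∎

  ◇ᵀ-y·y1 : ∀ v (P : Poly r) g →
            ⟨ P · y1 ∣ ◇ᵀ (v ▷₁ y₁) g ⟩ ≡ ⟨ P · y1 ∣ ◇ᵀ v (g ⊲ y1) ⟩ - ⟨ P ∣ ◇ᵀ (v ▷₁ x₁) (g ⊲ y1) ⟩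
  ◇ᵀ-y·y1 v P g = begin
      ⟨ P · y1 ∣ ◇ᵀ (v ▷₁ y₁) g ⟩
    ≡⟨ ⟨∣⟩-· P y1 _ ⟩
      ⟨ P ∣ ◇ᵀ (v ▷₁ y₁) g ⊲ y1 ⟩
    ≡⟨ ⟨∣⟩-congʳ P rule ⟩
      ⟨ P ∣ (λ q → ◇ᵀ v (g ⊲ y1) (q ▷ y1) - ◇ᵀ (v ▷₁ x₁) (g ⊲ y1) q) ⟩
    ≡⟨ ⟨∣⟩--ʳ P _ _ ⟩
      ⟨ P ∣ ◇ᵀ v (g ⊲ y1) ⊲ y1 ⟩ - ⟨ P ∣ ◇ᵀ (v ▷₁ x₁) (g ⊲ y1) ⟩
    ≡⟨ cong (_- ⟨ P ∣ ◇ᵀ (v ▷₁ x₁) (g ⊲ y1) ⟩) (sym (⟨∣⟩-· P y1 _)) ⟩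
      ⟨ P · y1 ∣ ◇ᵀ v (g ⊲ y1) ⟩ - ⟨ P ∣ ◇ᵀ (v ▷₁ x₁) (g ⊲ y1) ⟩ ∎
    where
    rule : ∀ q → ◇ᵀ (v ▷₁ y₁) g (q ▷ y1) ≡ ◇ᵀ v (g ⊲ y1) (q ▷ y1) - ◇ᵀ (v ▷₁ x₁) (g ⊲ y1) q
    rule q rewrite isOne-one {r = r} ⦃ it ⦄ = ⟨∣⟩-·⊖· (diaW s v (q ▷ y1)) (diaD s v x₁ q) y1 y1 g

  ◇ᵀ-y·y : ∀ v (P : Poly r) t → isOne t ≡ false → ∀ g →
           ⟨ P · y t ∣ ◇ᵀ (v ▷₁ y₁) g ⟩
           ≡ ⟨ P · y t ∣ ◇ᵀ v (g ⊲ y1) ⟩ - (⟨ P · x ∣ ◇ᵀ v (g ⊲ y t) ⟩ + ⟨ P · y t ∣ ◇ᵀ v (g ⊲ y t) ⟩)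
             + ⟨ P ∣ ◇ᵀ (v ▷₁ y₁) (g ⊲ y t) ⟩
  ◇ᵀ-y·y v P t t≢1 g = begin
      ⟨ P · y t ∣ ◇ᵀ (v ▷₁ y₁) g ⟩
    ≡⟨ ⟨∣⟩-· P (y t) _ ⟩
      ⟨ P ∣ ◇ᵀ (v ▷₁ y₁) g ⊲ y t ⟩
    ≡⟨ ⟨∣⟩-congʳ P rule ⟩
      ⟨ P ∣ (λ q → Dᵗ (g ⊲ y1) q - (Dˣ (g ⊲ y t) q + Dᵗ (g ⊲ y t) q) + ◇ᵀ (v ▷₁ y₁) (g ⊲ y t) q) ⟩
    ≡⟨ trans (⟨∣⟩-+ʳ P _ _) (cong (_+ ⟨ P ∣ ◇ᵀ (v ▷₁ y₁) (g ⊲ y t) ⟩)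
         (trans (⟨∣⟩--ʳ P _ _) (cong (λ a → ⟨ P ∣ Dᵗ (g ⊲ y1) ⟩ - a) (⟨∣⟩-+ʳ P _ _)))) ⟩
      ⟨ P ∣ Dᵗ (g ⊲ y1) ⟩ - (⟨ P ∣ Dˣ (g ⊲ y t) ⟩ + ⟨ P ∣ Dᵗ (g ⊲ y t) ⟩) + ⟨ P ∣ ◇ᵀ (v ▷₁ y₁) (g ⊲ y t) ⟩
    ≡⟨ cong (_+ ⟨ P ∣ ◇ᵀ (v ▷₁ y₁) (g ⊲ y t) ⟩)
         (cong₂ _-_ (sym (⟨∣⟩-· P (y t) _)) (cong₂ _+_ (sym (⟨∣⟩-· P x _)) (sym (⟨∣⟩-· P (y t) _)))) ⟩
      ⟨ P · y t ∣ ◇ᵀ v (g ⊲ y1) ⟩ - (⟨ P · x ∣ ◇ᵀ v (g ⊲ y t) ⟩ + ⟨ P · y t ∣ ◇ᵀ v (g ⊲ y t) ⟩)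
        + ⟨ P ∣ ◇ᵀ (v ▷₁ y₁) (g ⊲ y t) ⟩ ∎
    where
    Dˣ Dᵗ : (Word r → ℚ) → Word r → ℚ
    Dˣ h = ◇ᵀ v h ⊲ x
    Dᵗ h = ◇ᵀ v h ⊲ y t
    rule : ∀ q → ◇ᵀ (v ▷₁ y₁) g (q ▷ y t)
                 ≡ Dᵗ (g ⊲ y1) q - (Dˣ (g ⊲ y t) q + Dᵗ (g ⊲ y t) q) + ◇ᵀ (v ▷₁ y₁) (g ⊲ y t) q
    rule q rewrite t≢1 = begin
        ⟨ A · y1 ⊖ (B ⊕ A) · y t ⊕ C · y t ∣ g ⟩
      ≡⟨ ⟨∣⟩-++ (A · y1 ⊖ (B ⊕ A) · y t) (C · y t) g ⟩
        ⟨ A · y1 ⊖ (B ⊕ A) · y t ∣ g ⟩ + ⟨ C · y t ∣ g ⟩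
      ≡⟨ cong₂ _+_ (trans (⟨∣⟩-·⊖· A (B ⊕ A) y1 (y t) g)
                          (cong (λ a → ⟨ A ∣ g ⊲ y1 ⟩ - a) (⟨∣⟩-++ B A (g ⊲ y t))))
                   (⟨∣⟩-· C (y t) g) ⟩
        ⟨ A ∣ g ⊲ y1 ⟩ - (⟨ B ∣ g ⊲ y t ⟩ + ⟨ A ∣ g ⊲ y t ⟩) + ⟨ C ∣ g ⊲ y t ⟩ ∎
      where
      A = diaW s v (q ▷ y t)
      B = diaW s v (q ▷ x)
      C = diaD s v y₁ q

  -- The identity on words

  ◇ψ≡ψφ∗ : Word₁ → Word r → Set
  ◇ψ≡ψφ∗ v u = ∀ g → ⟨ ψW u ∣ ◇ᵀ v g ⟩ ≡ ψφ∗ v u g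

  ◇ψ≡ψφ∗-ε₁ : ∀ u → ◇ψ≡ψφ∗ ε₁ u
  ◇ψ≡ψφ∗-ε₁ u g = trans (⟨∣⟩-congʳ (ψW u) (λ q → ⟨∣⟩-word q g)) (sym (ψφ∗-ε₁ u g))

  ◇ψ≡ψφ∗-ε : ∀ v → ◇ψ≡ψφ∗ v ε
  ◇ψ≡ψφ∗-ε v g = trans (⟨∣⟩-word ε (◇ᵀ v g)) (trans (◇ᵀ-ε v g) (sym (ψφ∗-ε v g)))

  ◇ψ≡ψφ∗-▷x : ∀ v u → ◇ψ≡ψφ∗ v u → ◇ψ≡ψφ∗ (v ▷₁ y₁) u → ◇ψ≡ψφ∗ (v ▷₁ x₁) u
  ◇ψ≡ψφ∗-▷x v u ih ihʸ g = ∙-cancelʳ (ψφ∗ (v ▷₁ y₁) u g) _ _ (begin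
      ⟨ P ∣ ◇ᵀ (v ▷₁ x₁) g ⟩ + ψφ∗ (v ▷₁ y₁) u g
    ≡⟨ cong (⟨ P ∣ ◇ᵀ (v ▷₁ x₁) g ⟩ +_) (sym (ihʸ g)) ⟩
      ⟨ P ∣ ◇ᵀ (v ▷₁ x₁) g ⟩ + ⟨ P ∣ ◇ᵀ (v ▷₁ y₁) g ⟩
    ≡⟨ ⟨∣⟩-◇ᵀ-z v P g ⟩
      ⟨ P ∣ ◇ᵀ v (g ⊲ x) ⟩ + ⟨ P ∣ ◇ᵀ v (g ⊲ y1) ⟩
    ≡⟨ cong₂ _+_ (ih (g ⊲ x)) (ih (g ⊲ y1)) ⟩
      ψφ∗ v u (g ⊲ x) + ψφ∗ v u (g ⊲ y1)
    ≡⟨ sym (trans (ψφ∗-z v u g) (ψφ∗-x v u g)) ⟩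
      ψφ∗ (v ▷₁ x₁) u g + ψφ∗ (v ▷₁ y₁) u g ∎)
    where
    P = ψW u

  module _ (v : Word₁) (u : Word r) (ihˣ : ◇ψ≡ψφ∗ (v ▷₁ x₁) u) (ihʸ : ◇ψ≡ψφ∗ (v ▷₁ y₁) u)
           (ih-ux : ◇ψ≡ψφ∗ v (u ▷ x)) where

    private
      P = ψW u
      Dᵛ : Letter r → (Word r → ℚ) → ℚ
      Dᵛ a h = ⟨ P · a ∣ ◇ᵀ v h ⟩
      Dˣ Dʸ : (Word r → ℚ) → ℚ
      Dˣ h = ⟨ P ∣ ◇ᵀ (v ▷₁ x₁) h ⟩
      Dʸ h = ⟨ P ∣ ◇ᵀ (v ▷₁ y₁) h ⟩
      Rˣ Rʸ : (Word r → ℚ) → ℚ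
      Rˣ = ψφ∗ (v ▷₁ x₁) u
      Rʸ = ψφ∗ (v ▷₁ y₁) u

      Dᵛ-z : ∀ h → Dᵛ x h + Dᵛ y1 h ≡ ψφ∗ v (u ▷ x) h
      Dᵛ-z h = trans (sym (⟨∣⟩-++ (P · x) (P · y1) (◇ᵀ v h))) (ih-ux h)

    ◇ψ≡ψφ∗-▷y-x : ◇ψ≡ψφ∗ (v ▷₁ y₁) (u ▷ x)
    ◇ψ≡ψφ∗-▷y-x g = begin
        ⟨ P · x ⊕ P · y1 ∣ ◇ᵀ (v ▷₁ y₁) g ⟩
      ≡⟨ ⟨∣⟩-++ (P · x) (P · y1) (◇ᵀ (v ▷₁ y₁) g) ⟩
        ⟨ P · x ∣ ◇ᵀ (v ▷₁ y₁) g ⟩ + ⟨ P · y1 ∣ ◇ᵀ (v ▷₁ y₁) g ⟩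
      ≡⟨ cong₂ _+_ (◇ᵀ-y·x v P g) (◇ᵀ-y·y1 v P g) ⟩
        Dᵛ x (g ⊲ y1) + Dʸ (g ⊲ x) + (Dᵛ y1 (g ⊲ y1) - Dˣ (g ⊲ y1))
      ≡⟨ solve 4 (λ a b c d → a :+ b :+ (c :- d) := (a :+ c) :+ b :- d) refl
                 (Dᵛ x (g ⊲ y1)) (Dʸ (g ⊲ x)) (Dᵛ y1 (g ⊲ y1)) (Dˣ (g ⊲ y1)) ⟩
        (Dᵛ x (g ⊲ y1) + Dᵛ y1 (g ⊲ y1)) + Dʸ (g ⊲ x) - Dˣ (g ⊲ y1)
      ≡⟨ cong₂ _-_ (cong₂ _+_ (trans (Dᵛ-z (g ⊲ y1)) (sym (ψφ∗-z v u (g ⊲ y1)))) (ihʸ (g ⊲ x))) (ihˣ (g ⊲ y1)) ⟩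
        (Rˣ (g ⊲ y1) + Rʸ (g ⊲ y1)) + Rʸ (g ⊲ x) - Rˣ (g ⊲ y1)
      ≡⟨ solve 3 (λ a b c → (a :+ b) :+ c :- a := c :+ b) refl (Rˣ (g ⊲ y1)) (Rʸ (g ⊲ y1)) (Rʸ (g ⊲ x)) ⟩
        Rʸ (g ⊲ x) + Rʸ (g ⊲ y1)
      ≡⟨ sym (ψφ∗-x (v ▷₁ y₁) u g) ⟩
        ψφ∗ (v ▷₁ y₁) (u ▷ x) g ∎

    ◇ψ≡ψφ∗-▷y-y : ∀ t → ◇ψ≡ψφ∗ v (u ▷ y t) → ◇ψ≡ψφ∗ (v ▷₁ y₁) (u ▷ y t)
    ◇ψ≡ψφ∗-▷y-y t ih-uy g = by-cases (isOne c) refl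
      where
      c = mul s (mul (prodY u) t)
      g¹ = g ⊲ y1
      gᶜ = g ⊲ y c
      R-uy R-ux : (Word r → ℚ) → ℚ
      R-uy = ψφ∗ v (u ▷ y t)
      R-ux = ψφ∗ v (u ▷ x)

      expanded : ℚ → ℚ
      expanded d = (d * Rʸ gᶜ - Rʸ g¹) - (d * R-uy gᶜ - R-uy g¹) - (d * R-ux gᶜ - (Rˣ g¹ + Rʸ g¹))

      rhs : ψφ∗ (v ▷₁ y₁) (u ▷ y t) g ≡ expanded (δ c)
      rhs = begin
          ψφ∗ (v ▷₁ y₁) (u ▷ y t) g
        ≡⟨ ψφ∗-y v u t g ⟩
          Rʸ (φᵀy c g) - R-uy (φᵀy c g) - R-ux (φᵀy c g)
        ≡⟨ cong₂ _-_ (cong₂ _-_ (ψφ∗-φᵀy (v ▷₁ y₁) u c g) (ψφ∗-φᵀy v (u ▷ y t) c g)) (ψφ∗-φᵀy v (u ▷ x) c g) ⟩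
          (δ c * Rʸ gᶜ - Rʸ g¹) - (δ c * R-uy gᶜ - R-uy g¹) - (δ c * R-ux gᶜ - R-ux g¹)
        ≡⟨ cong (λ z → (δ c * Rʸ gᶜ - Rʸ g¹) - (δ c * R-uy gᶜ - R-uy g¹) - (δ c * R-ux gᶜ - z))
                (sym (ψφ∗-z v u g¹)) ⟩
          expanded (δ c) ∎

      c≡1-case : isOne c ≡ true → ⟨ ψW (u ▷ y t) ∣ ◇ᵀ (v ▷₁ y₁) g ⟩ ≡ ψφ∗ (v ▷₁ y₁) (u ▷ y t) g
      c≡1-case c≡1 = begin
          ⟨ ψW (u ▷ y t) ∣ ◇ᵀ (v ▷₁ y₁) g ⟩
        ≡⟨ cong (λ W → ⟨ W ∣ ◇ᵀ (v ▷₁ y₁) g ⟩) ψ≡ ⟩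
          ⟨ neg (P · y1) ∣ ◇ᵀ (v ▷₁ y₁) g ⟩
        ≡⟨ trans (⟨∣⟩-neg (P · y1) _) (cong -_ (◇ᵀ-y·y1 v P g)) ⟩
          - (Dᵛ y1 g¹ - Dˣ g¹)
        ≡⟨ solve 2 (λ a b → :- (a :- b) := :- a :+ b) refl (Dᵛ y1 g¹) (Dˣ g¹) ⟩
          - Dᵛ y1 g¹ + Dˣ g¹
        ≡⟨ cong₂ _+_ (ih-uy′ g¹) (ihˣ g¹) ⟩
          R-uy g¹ + Rˣ g¹
        ≡⟨ solve 6 (λ Zc X₁ Tc T₁ Yc Y₁ →
                      T₁ :+ X₁
                      := (con 0ℚ :* Yc :- Y₁) :- (con 0ℚ :* Tc :- T₁) :- (con 0ℚ :* Zc :- (X₁ :+ Y₁)))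
                   refl (R-ux gᶜ) (Rˣ g¹) (R-uy gᶜ) (R-uy g¹) (Rʸ gᶜ) (Rʸ g¹) ⟩
          expanded 0ℚ
        ≡⟨ cong expanded (sym δc≡0) ⟩
          expanded (δ c)
        ≡⟨ sym rhs ⟩
          ψφ∗ (v ▷₁ y₁) (u ▷ y t) g ∎
        where
        ψ≡ = ψW-y-one u t c≡1
        δc≡0 : δ c ≡ 0ℚ
        δc≡0 = cong (λ b → if b then 0ℚ else 1ℚ) c≡1
        ih-uy′ : ∀ h → - Dᵛ y1 h ≡ R-uy h
        ih-uy′ h = trans (sym (⟨∣⟩-neg (P · y1) (◇ᵀ v h)))
                         (trans (cong (λ W → ⟨ W ∣ ◇ᵀ v h ⟩) (sym ψ≡)) (ih-uy h))

      c≢1-case : isOne c ≡ false → ⟨ ψW (u ▷ y t) ∣ ◇ᵀ (v ▷₁ y₁) g ⟩ ≡ ψφ∗ (v ▷₁ y₁) (u ▷ y t) g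
      c≢1-case c≢1 = begin
          ⟨ ψW (u ▷ y t) ∣ ◇ᵀ (v ▷₁ y₁) g ⟩
        ≡⟨ cong (λ W → ⟨ W ∣ ◇ᵀ (v ▷₁ y₁) g ⟩) ψ≡ ⟩
          ⟨ P · y c ⊖ P · y1 ∣ ◇ᵀ (v ▷₁ y₁) g ⟩
        ≡⟨ trans (⟨∣⟩-⊖ (P · y c) (P · y1) _) (cong₂ _-_ (◇ᵀ-y·y v P c c≢1 g) (◇ᵀ-y·y1 v P g)) ⟩
          (Dᵛ (y c) g¹ - (Dᵛ x gᶜ + Dᵛ (y c) gᶜ) + Dʸ gᶜ) - (Dᵛ y1 g¹ - Dˣ g¹)
        ≡⟨ solve 7 (λ a b c d e f k → (a :- (b :+ c) :+ d) :- (e :- f) :=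
                                      (a :- e) :- ((b :+ k) :+ (c :- k)) :+ d :+ f)
                   refl (Dᵛ (y c) g¹) (Dᵛ x gᶜ) (Dᵛ (y c) gᶜ) (Dʸ gᶜ) (Dᵛ y1 g¹) (Dˣ g¹) (Dᵛ y1 gᶜ) ⟩
          (Dᵛ (y c) g¹ - Dᵛ y1 g¹) - ((Dᵛ x gᶜ + Dᵛ y1 gᶜ) + (Dᵛ (y c) gᶜ - Dᵛ y1 gᶜ)) + Dʸ gᶜ + Dˣ g¹
        ≡⟨ cong₂ _+_ (cong₂ _+_ (cong₂ _-_ (ih-uy′ g¹) (cong₂ _+_ (Dᵛ-z gᶜ) (ih-uy′ gᶜ))) (ihʸ gᶜ)) (ihˣ g¹) ⟩
          R-uy g¹ - (R-ux gᶜ + R-uy gᶜ) + Rʸ gᶜ + Rˣ g¹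
        ≡⟨ solve 6 (λ Zc X₁ Tc T₁ Yc Y₁ →
                      T₁ :- (Zc :+ Tc) :+ Yc :+ X₁
                      := (con 1ℚ :* Yc :- Y₁) :- (con 1ℚ :* Tc :- T₁) :- (con 1ℚ :* Zc :- (X₁ :+ Y₁)))
                   refl (R-ux gᶜ) (Rˣ g¹) (R-uy gᶜ) (R-uy g¹) (Rʸ gᶜ) (Rʸ g¹) ⟩
          expanded 1ℚ
        ≡⟨ cong expanded (sym δc≡1) ⟩
          expanded (δ c)
        ≡⟨ sym rhs ⟩
          ψφ∗ (v ▷₁ y₁) (u ▷ y t) g ∎
        where
        ψ≡ = ψW-y-other u t c≢1
        δc≡1 : δ c ≡ 1ℚ
        δc≡1 = cong (λ b → if b then 0ℚ else 1ℚ) c≢1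
        ih-uy′ : ∀ h → Dᵛ (y c) h - Dᵛ y1 h ≡ R-uy h
        ih-uy′ h = trans (sym (⟨∣⟩-⊖ (P · y c) (P · y1) (◇ᵀ v h)))
                         (trans (cong (λ W → ⟨ W ∣ ◇ᵀ v h ⟩) (sym ψ≡)) (ih-uy h))

      by-cases : ∀ b → isOne c ≡ b → ⟨ ψW (u ▷ y t) ∣ ◇ᵀ (v ▷₁ y₁) g ⟩ ≡ ψφ∗ (v ▷₁ y₁) (u ▷ y t) g
      by-cases true = c≡1-case
      by-cases false = c≢1-case

  ◇ψ≡ψφ∗-▷y : ∀ v → (∀ u → ◇ψ≡ψφ∗ v u) → ∀ u → ◇ψ≡ψφ∗ (v ▷₁ y₁) u
  ◇ψ≡ψφ∗-▷y v ih ε = ◇ψ≡ψφ∗-ε (v ▷₁ y₁)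
  ◇ψ≡ψφ∗-▷y v ih (u ▷ a) = step a
    where
    ihʸ = ◇ψ≡ψφ∗-▷y v ih u
    ihˣ = ◇ψ≡ψφ∗-▷x v u (ih u) ihʸ
    step : ∀ a → ◇ψ≡ψφ∗ (v ▷₁ y₁) (u ▷ a)
    step x = ◇ψ≡ψφ∗-▷y-x v u ihˣ ihʸ (ih (u ▷ x))
    step (y t) = ◇ψ≡ψφ∗-▷y-y v u ihˣ ihʸ (ih (u ▷ x)) t (ih (u ▷ y t))

  ◇ψ≡ψφ∗-words : ∀ v u → ◇ψ≡ψφ∗ v u
  ◇ψ≡ψφ∗-words ε₁ = ◇ψ≡ψφ∗-ε₁
  ◇ψ≡ψφ∗-words (v ▷₁ y₁) = ◇ψ≡ψφ∗-▷y v (◇ψ≡ψφ∗-words v)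
  ◇ψ≡ψφ∗-words (v ▷₁ x₁) u = ◇ψ≡ψφ∗-▷x v u (◇ψ≡ψφ∗-words v u) (◇ψ≡ψφ∗-▷y v (◇ψ≡ψφ∗-words v) u)

  ◇-ψ : ∀ (v : Poly₁) (u : Poly r) → ◇ s v (ψ s u) ≈ ψ s (φ₁ v ∗ u)
  ◇-ψ v u w = begin
      coeff (◇ s v (ψ s u)) w
    ≡⟨ coeff≡⟨∣indicator⟩ (◇ s v (ψ s u)) w ⟩
      ⟨ ◇ s v (ψ s u) ∣ g ⟩
    ≡⟨ ⟨∣⟩-bilin₁ (diaW s) v (ψ s u) g ⟩
      ⟨ v ∣ (λ a → ⟨ ψ s u ∣ ◇ᵀ a g ⟩) ⟩
    ≡⟨ ⟨∣⟩-congʳ v (λ a → ⟨∣⟩-lin ψW u (◇ᵀ a g)) ⟩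
      ⟨ v ∣ (λ a → ⟨ u ∣ (λ b → ⟨ ψW b ∣ ◇ᵀ a g ⟩) ⟩) ⟩
    ≡⟨ ⟨∣⟩-congʳ v (λ a → ⟨∣⟩-congʳ u (λ b → ◇ψ≡ψφ∗-words a b g)) ⟩
      ⟨ v ∣ (λ a → ⟨ u ∣ (λ b → ψφ∗ a b g) ⟩) ⟩
    ≡⟨ ⟨∣⟩-congʳ v (λ a → ⟨∣⟩-swap u (φ₁W a) (λ b p → ⟨ harmW p b ∣ ψᵀ g ⟩)) ⟩
      ⟨ v ∣ (λ a → ⟨ φ₁W a ∣ (λ p → ⟨ u ∣ (λ b → ⟨ harmW p b ∣ ψᵀ g ⟩) ⟩) ⟩) ⟩
    ≡⟨ sym (⟨∣⟩-lin₁ φ₁W v _) ⟩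
      ⟨ φ₁ v ∣ (λ p → ⟨ u ∣ (λ b → ⟨ harmW p b ∣ ψᵀ g ⟩) ⟩) ⟩
    ≡⟨ sym (⟨∣⟩-bilin harmW (φ₁ v) u (ψᵀ g)) ⟩
      ⟨ φ₁ v ∗ u ∣ ψᵀ g ⟩
    ≡⟨ sym (⟨∣⟩-lin ψW (φ₁ v ∗ u) g) ⟩
      ⟨ ψ s (φ₁ v ∗ u) ∣ g ⟩
    ≡⟨ sym (coeff≡⟨∣indicator⟩ (ψ s (φ₁ v ∗ u)) w) ⟩
      coeff (ψ s (φ₁ v ∗ u)) w ∎
    where
    g = indicator w

  ◇-congʳ : ∀ (v : Poly₁) (w w′ : Poly r) → w ≈ w′ → ◇ s v w ≈ ◇ s v w′
  ◇-congʳ v w w′ w≈w′ z = begin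
      coeff (◇ s v w) z
    ≡⟨ coeff≡⟨∣indicator⟩ (◇ s v w) z ⟩
      ⟨ ◇ s v w ∣ indicator z ⟩
    ≡⟨ ⟨∣⟩-bilin₁ (diaW s) v w (indicator z) ⟩
      ⟨ v ∣ (λ a → ⟨ w ∣ ◇ᵀ a (indicator z) ⟩) ⟩
    ≡⟨ ⟨∣⟩-congʳ v (λ a → ⟨∣⟩-resp-≈ w w′ (◇ᵀ a (indicator z)) w≈w′) ⟩
      ⟨ v ∣ (λ a → ⟨ w′ ∣ ◇ᵀ a (indicator z) ⟩) ⟩
    ≡⟨ sym (⟨∣⟩-bilin₁ (diaW s) v w′ (indicator z)) ⟩
      ⟨ ◇ s v w′ ∣ indicator z ⟩
    ≡⟨ sym (coeff≡⟨∣indicator⟩ (◇ s v w′) z) ⟩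
      coeff (◇ s v w′) z ∎

proposition5p4 : (r : ℕ) .{{_ : NonZero r}} (s : Fin r) (v : Poly₁) (w u : Poly r)
                 → ψ s u ≈ w → ◇ s v w ≈ ψ s (φ₁ v ∗ u)
proposition5p4 r s v w u ψu≈w z = trans (◇-congʳ s v w (ψ s u) (λ w′ → sym (ψu≈w w′)) z) (◇-ψ s v u z)
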